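{- Let $f\in\mathbb{F}[X]$ be a polynomial computed by an interval formula $F$ of size $s$ and depth $d$. Then $f$ can also be computed by an interval formula of size $\mathrm{poly}(s)$ and depth $O(\log s)$.
   Context: $X=\{x_1,\ldots,x_n\}$; for $i<j$, $X_{ij}=\{x_p: i\le p\le j\}$. An arithmetic formula is a tree-shaped circuit with $+,\times$ gates and leaves labeled by variables or field constants; size is the number of gates and depth the length of the longest root-to-leaf path. An interval formula is an arithmetic formula such that for every gate $g$ there is an interval $[i,j]$, $i<j$, with $g$ computing a polynomial in $X_{ij}$, and for every product gate $g=h_1\times h_2$ the intervals corresponding to $h_1$ and $h_2$ are non-overlapping; the interval of a sum gate with inputs on intervals $I_1,I_2$ is $I_1\cup I_2$. -}

module Defs where

open import Level using (Level; _⊔_; suc)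
open import Algebra.Bundles using (CommutativeRing)
open import Data.Nat as ℕ using (ℕ; zero; _<_; _≤_; _⊔_)
open import Data.Nat.Logarithm using (⌊log₂_⌋)
open import Data.Fin using (Fin; toℕ)
open import Data.Maybe using (Maybe; just; nothing)
open import Data.Product using (_×_; _,_; Σ; ∃)
open import Data.Sum using (_⊎_)
open import Data.Unit using (⊤)
open import Relation.Nullary using (¬_)

record Field (c ℓ : Level) : Set (Level.suc (c Level.⊔ ℓ)) where
  field
    commutativeRing : CommutativeRing c ℓ
  open CommutativeRing commutativeRing public
  field
    0≉1     : ¬ (0# ≈ 1#)
    inverse : ∀ x → ¬ (x ≈ 0#) → Σ Carrier (λ y → (x * y) ≈ 1#)

-- Arithmetic formulas over a field 𝔽 in the variables x_0,…,x_{n-1}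
-- (indices shifted by one w.r.t. the paper's x_1,…,x_n).

module _ {c ℓ : Level} (𝔽 : Field c ℓ) where
  open Field 𝔽 using (Carrier; _≈_; _+_; _*_; -_; 0#; 1#)

  data Formula (n : ℕ) : Set c where
    var   : Fin n → Formula n
    const : Carrier → Formula n
    _⊕_   : Formula n → Formula n → Formula n
    _⊗_   : Formula n → Formula n → Formula n

  infixl 6 _⊕_
  infixl 7 _⊗_

  size : ∀ {n} → Formula n → ℕ
  size (var _)   = 0
  size (const _) = 0
  size (f ⊕ g)   = ℕ.suc (size f ℕ.+ size g)
  size (f ⊗ g)   = ℕ.suc (size f ℕ.+ size g)

  depth : ∀ {n} → Formula n → ℕ
  depth (var _)   = 0
  depth (const _) = 0
  depth (f ⊕ g)   = ℕ.suc (depth f ℕ.⊔ depth g)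
  depth (f ⊗ g)   = ℕ.suc (depth f ℕ.⊔ depth g)

  -- "f and g compute the same polynomial of 𝔽[X]": the congruence on
  -- formulas generated by the commutative-ring axioms together with the
  -- identification of constant subterms with their values in 𝔽.
  -- The quotient Formula n / ≋ is the polynomial ring 𝔽[x_0,…,x_{n-1}].

  infix 4 _≋_
  data _≋_ {n : ℕ} : Formula n → Formula n → Set (c Level.⊔ ℓ) where
    ≋-refl  : ∀ {f} → f ≋ f
    ≋-sym   : ∀ {f g} → f ≋ g → g ≋ f
    ≋-trans : ∀ {f g h} → f ≋ g → g ≋ h → f ≋ h
    ⊕-cong  : ∀ {f f′ g g′} → f ≋ f′ → g ≋ g′ → f ⊕ g ≋ f′ ⊕ g′
    ⊗-cong  : ∀ {f f′ g g′} → f ≋ f′ → g ≋ g′ → f ⊗ g ≋ f′ ⊗ g′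
    ⊕-assoc : ∀ f g h → (f ⊕ g) ⊕ h ≋ f ⊕ (g ⊕ h)
    ⊕-comm  : ∀ f g → f ⊕ g ≋ g ⊕ f
    ⊕-zero  : ∀ f → f ⊕ const 0# ≋ f
    ⊕-neg   : ∀ f → f ⊕ (const (- 1#) ⊗ f) ≋ const 0#
    ⊗-assoc : ∀ f g h → (f ⊗ g) ⊗ h ≋ f ⊗ (g ⊗ h)
    ⊗-comm  : ∀ f g → f ⊗ g ≋ g ⊗ f
    ⊗-one   : ∀ f → f ⊗ const 1# ≋ f
    ⊗-distrib : ∀ f g h → f ⊗ (g ⊕ h) ≋ (f ⊗ g) ⊕ (f ⊗ h)
    const-≈ : ∀ {a b} → a ≈ b → const a ≋ const b
    const-+ : ∀ a b → const a ⊕ const b ≋ const (a + b)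
    const-* : ∀ a b → const a ⊗ const b ≋ const (a * b)

  -- An interval is a pair (i , j) with i ≤ j, denoting {x_p : i ≤ p ≤ j}.
  -- `span f` is the smallest interval containing all variables occurring
  -- in f (nothing if f contains no variable); the interval of a sum gate
  -- is the union (hull) of the intervals of its inputs.

  hull : Maybe (ℕ × ℕ) → Maybe (ℕ × ℕ) → Maybe (ℕ × ℕ)
  hull nothing         J               = J
  hull (just I)        nothing         = just I
  hull (just (i , j))  (just (k , l))  = just (i ℕ.⊓ k , j ℕ.⊔ l)

  span : ∀ {n} → Formula n → Maybe (ℕ × ℕ)
  span (var p)   = just (toℕ p , toℕ p)
  span (const _) = nothing
  span (f ⊕ g)   = hull (span f) (span g)
  span (f ⊗ g)   = hull (span f) (span g)

  NonOverlapping : Maybe (ℕ × ℕ) → Maybe (ℕ × ℕ) → Set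
  NonOverlapping nothing        _              = ⊤
  NonOverlapping (just _)       nothing        = ⊤
  NonOverlapping (just (i , j)) (just (k , l)) = (j < k) ⊎ (l < i)

  IsInterval : ∀ {n} → Formula n → Set
  IsInterval (var _)   = ⊤
  IsInterval (const _) = ⊤
  IsInterval (f ⊕ g)   = IsInterval f × IsInterval g
  IsInterval (f ⊗ g)   = IsInterval f × IsInterval g × NonOverlapping (span f) (span g)

-- Brent's depth reduction, adapted to interval formulas. If M ≤ |F| < 2M,
-- walking down from the root into inputs of size ≥ M ends at a gate p of
-- size ≥ M whose inputs have size < M. Every gate on that path is linear in
-- p, so F = A·p + B. In an interval formula each factor multiplied into A
-- along the path lies entirely to the left or entirely to the right of p, so
-- A splits as L·R with L left of p and p left of R, and L·p·R + B is again an
-- interval formula. As |L| + |R| + |p| and |B| + |p| are at most |F| < 2M,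
-- the formulas L, R, B and the inputs of p all have size < M; balancing them
-- recursively costs 4 in depth and a factor 8 in size per halving of M,
-- hence depth O(log s) and size O(s³).
module Submission where

open import Defs
open import Level using (Level)
open import Data.Nat using (ℕ; _≤_; _*_; _+_; _^_; suc)
open import Data.Nat.Logarithm using (⌊log₂_⌋)
open import Data.Product using (Σ; _×_)

open import Level using () renaming (_⊔_ to _⊔ˡ_)
open import Data.Nat using (zero; _<_; NonZero; ⌊_/2⌋; _≤?_; _<?_; z≤n; s≤s)
open import Data.Nat.Properties
open import Data.Nat.Logarithm using (⌊log₂⌋-mono-≤; ⌊log₂[2^n]⌋≡n)
open import Data.Nat.Logarithm.Core using (⌊log2⌋)
open import Data.Nat.Tactic.RingSolver using (solve-∀)
open import Data.Maybe using (Maybe; just; nothing)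
open import Data.Product using (_,_)
open import Data.Sum using (_⊎_; inj₁; inj₂; swap)
open import Data.Unit using (tt)
open import Data.Empty using (⊥-elim)
open import Induction.WellFounded using (Acc; acc)
open import Relation.Nullary using (yes; no)
open import Relation.Binary.Bundles using (Setoid)
import Relation.Binary.Reasoning.Setoid as SetoidReasoning
open import Relation.Binary.PropositionalEquality using (_≡_; refl; sym; trans; cong; subst)

m+n<2o⇒o≤n⇒m<o : ∀ {m n o} → m + n < 2 * o → o ≤ n → m < o
m+n<2o⇒o≤n⇒m<o {m} {n} {o} m+n<2o o≤n =
  +-cancelʳ-< o m o (≤-<-trans (+-monoʳ-≤ m o≤n) (subst (m + n <_) (cong (o +_) (+-identityʳ o)) m+n<2o))

m<o⇒n<p⇒1+[m+n]<o+p : ∀ {x y s s′} → x < s → y < s′ → suc (x + y) < s + s′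
m<o⇒n<p⇒1+[m+n]<o+p {x} {y} {s} {s′} x<s y<s′ = subst (_≤ s + s′) (+-suc (suc x) y) (+-mono-≤ x<s y<s′)

+-grow-≤ : ∀ x b {x′ y a} → x′ ≡ suc (x + b) → x + y ≤ a → x′ + y ≤ suc (a + b)
+-grow-≤ x b {y = y} {a} refl x+y≤a =
  s≤s (subst (_≤ a + b) (+-comm-middle x y b) (+-monoˡ-≤ b x+y≤a))
  where
    +-comm-middle : ∀ x y b → x + y + b ≡ x + b + y
    +-comm-middle = solve-∀

x+[x+x]+x+x≤8x : ∀ x → x + (x + x) + x + x ≤ 8 * x
x+[x+x]+x+x≤8x x = subst (x + (x + x) + x + x ≤_) (sym (eightfold x)) (m≤m+n _ (3 * x))
  where
    eightfold : ∀ x → 8 * x ≡ x + (x + x) + x + x + 3 * x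
    eightfold = solve-∀

2*⌊n/2⌋≤n : ∀ n → 2 * ⌊ n /2⌋ ≤ n
2*⌊n/2⌋≤n zero          = z≤n
2*⌊n/2⌋≤n (suc zero)    = z≤n
2*⌊n/2⌋≤n (suc (suc n)) = subst (_≤ 2 + n) (sym (*-suc 2 ⌊ n /2⌋)) (+-monoʳ-≤ 2 (2*⌊n/2⌋≤n n))

2^⌊log2⌋≤n : ∀ n .{{_ : NonZero n}} (rec : Acc _<_ n) → 2 ^ ⌊log2⌋ n rec ≤ n
2^⌊log2⌋≤n (suc zero)    _        = ≤-refl
2^⌊log2⌋≤n (suc (suc n)) (acc rs) =
  ≤-trans (*-monoʳ-≤ 2 (2^⌊log2⌋≤n (suc ⌊ n /2⌋) (rs (⌊n/2⌋<n (suc n))))) (2*⌊n/2⌋≤n (suc (suc n)))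

2^⌊log₂n⌋≤n : ∀ n .{{_ : NonZero n}} → 2 ^ ⌊log₂ n ⌋ ≤ n
2^⌊log₂n⌋≤n n = 2^⌊log2⌋≤n n _

n<2^[1+⌊log₂n⌋] : ∀ n → n < 2 ^ suc ⌊log₂ n ⌋
n<2^[1+⌊log₂n⌋] n = ≰⇒> λ 2^[1+⌊log₂n⌋]≤n →
  1+n≰n (subst (_≤ ⌊log₂ n ⌋) (⌊log₂[2^n]⌋≡n _) (⌊log₂⌋-mono-≤ 2^[1+⌊log₂n⌋]≤n))

bitLength : ℕ → ℕ
bitLength zero      = zero
bitLength n@(suc _) = suc ⌊log₂ n ⌋

n<2^bitLength : ∀ n → n < 2 ^ bitLength n
n<2^bitLength zero      = s≤s z≤n
n<2^bitLength n@(suc _) = n<2^[1+⌊log₂n⌋] n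

bitLength≤1+⌊log₂n⌋ : ∀ n → bitLength n ≤ suc ⌊log₂ n ⌋
bitLength≤1+⌊log₂n⌋ zero    = z≤n
bitLength≤1+⌊log₂n⌋ (suc _) = ≤-refl

8^n≡[2^n]^3 : ∀ n → 8 ^ n ≡ (2 ^ n) ^ 3
8^n≡[2^n]^3 n = trans (^-*-assoc 2 3 n) (trans (cong (2 ^_) (*-comm 3 n)) (sym (^-*-assoc 2 n 3)))

2n≤[1+n]^2 : ∀ n → 2 * n ≤ suc n ^ 2
2n≤[1+n]^2 n = subst (2 * n ≤_) (sym (square n)) (m≤m+n (2 * n) _)
  where
    square : ∀ n → suc n * (suc n * 1) ≡ 2 * n + (1 + n * n)
    square = solve-∀

8^bitLength≤[1+n]^6 : ∀ n → 8 ^ bitLength n ≤ suc n ^ 6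
8^bitLength≤[1+n]^6 zero      = ≤-refl
8^bitLength≤[1+n]^6 n@(suc _) = begin
  8 ^ suc ⌊log₂ n ⌋        ≡⟨ 8^n≡[2^n]^3 (suc ⌊log₂ n ⌋) ⟩
  (2 ^ suc ⌊log₂ n ⌋) ^ 3  ≤⟨ ^-monoˡ-≤ 3 (*-monoʳ-≤ 2 (2^⌊log₂n⌋≤n n)) ⟩
  (2 * n) ^ 3              ≤⟨ ^-monoˡ-≤ 3 (2n≤[1+n]^2 n) ⟩
  (suc n ^ 2) ^ 3          ≡⟨ ^-*-assoc (suc n) 2 3 ⟩
  suc n ^ 6                ∎
  where open ≤-Reasoning

Interval : Set
Interval = Maybe (ℕ × ℕ)

infix 4 _⊆_ _≺_

data _⊆_ : Interval → Interval → Set where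
  nothing⊆ : ∀ {J} → nothing ⊆ J
  just⊆    : ∀ {i j k l} → k ≤ i → j ≤ l → just (i , j) ⊆ just (k , l)

data _≺_ : Interval → Interval → Set where
  nothing≺ : ∀ {J} → nothing ≺ J
  ≺nothing : ∀ {I} → I ≺ nothing
  just≺    : ∀ {i j k l} → j < k → just (i , j) ≺ just (k , l)

⊆-refl : ∀ {I} → I ⊆ I
⊆-refl {nothing}      = nothing⊆
⊆-refl {just (i , j)} = just⊆ ≤-refl ≤-refl

⊆-trans : ∀ {I J K} → I ⊆ J → J ⊆ K → I ⊆ K
⊆-trans nothing⊆     _           = nothing⊆
⊆-trans (just⊆ a b) (just⊆ c d) = just⊆ (≤-trans c a) (≤-trans b d)

≺-resp-⊆ : ∀ {I J I′ J′} → I′ ⊆ I → J′ ⊆ J → I ≺ J → I′ ≺ J′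
≺-resp-⊆ nothing⊆    _           _          = nothing≺
≺-resp-⊆ (just⊆ _ _) nothing⊆    _          = ≺nothing
≺-resp-⊆ (just⊆ _ b) (just⊆ c _) (just≺ lt) = just≺ (≤-<-trans b (<-≤-trans lt c))

module _ {c ℓ : Level} (𝔽 : Field c ℓ) where
  open Field 𝔽 using (0#; 1#)

  private
    _∪_ : Interval → Interval → Interval
    _∪_ = hull 𝔽

  ∪-upperˡ : ∀ I J → I ⊆ I ∪ J
  ∪-upperˡ nothing        _              = nothing⊆
  ∪-upperˡ (just (i , j)) nothing        = ⊆-refl
  ∪-upperˡ (just (i , j)) (just (k , l)) = just⊆ (m⊓n≤m i k) (m≤m⊔n j l)

  ∪-upperʳ : ∀ I J → J ⊆ I ∪ J
  ∪-upperʳ nothing        _              = ⊆-refl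
  ∪-upperʳ (just (i , j)) nothing        = nothing⊆
  ∪-upperʳ (just (i , j)) (just (k , l)) = just⊆ (m⊓n≤n i k) (m≤n⊔m j l)

  ∪-least : ∀ {I J K} → I ⊆ K → J ⊆ K → I ∪ J ⊆ K
  ∪-least nothing⊆    q           = q
  ∪-least (just⊆ a b) nothing⊆    = just⊆ a b
  ∪-least (just⊆ a b) (just⊆ c d) = just⊆ (⊓-glb a c) (⊔-lub b d)

  ∪-mono : ∀ {I J I′ J′} → I ⊆ I′ → J ⊆ J′ → I ∪ J ⊆ I′ ∪ J′
  ∪-mono {I′ = I′} {J′} p q = ∪-least (⊆-trans p (∪-upperˡ I′ J′)) (⊆-trans q (∪-upperʳ I′ J′))

  ∪-comm-⊆ : ∀ I J → I ∪ J ⊆ J ∪ I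
  ∪-comm-⊆ I J = ∪-least (∪-upperʳ J I) (∪-upperˡ J I)

  ∪-≺ : ∀ {I J K} → I ≺ K → J ≺ K → I ∪ J ≺ K
  ∪-≺ {nothing}                  _         q          = q
  ∪-≺ {just _} {nothing}         p         _          = p
  ∪-≺ {just _} {just _}          ≺nothing  _          = ≺nothing
  ∪-≺ {just _} {just _}          (just≺ a) (just≺ b)  = just≺ (⊔-lub a b)

  ≺-∪ : ∀ {I J K} → I ≺ J → I ≺ K → I ≺ J ∪ K
  ≺-∪ nothing≺                    _           = nothing≺
  ≺-∪ ≺nothing                    q           = q
  ≺-∪ {just _} {just _} p         ≺nothing    = p
  ≺-∪ {just _} {just _} (just≺ a) (just≺ b)   = just≺ (⊓-glb a b)

  ≺⇒nonOverlapping : ∀ {I J} → I ≺ J → NonOverlapping 𝔽 I J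
  ≺⇒nonOverlapping nothing≺               = tt
  ≺⇒nonOverlapping {nothing} ≺nothing     = tt
  ≺⇒nonOverlapping {just _}  ≺nothing     = tt
  ≺⇒nonOverlapping (just≺ lt)             = inj₁ lt

  ≻⇒nonOverlapping : ∀ {I J} → J ≺ I → NonOverlapping 𝔽 I J
  ≻⇒nonOverlapping {nothing}            _          = tt
  ≻⇒nonOverlapping {just _} {nothing}   _          = tt
  ≻⇒nonOverlapping {just _} {just _}    (just≺ lt) = inj₂ lt

  nonOverlapping⇒≺⊎≻ : ∀ {I J} → NonOverlapping 𝔽 I J → I ≺ J ⊎ J ≺ I
  nonOverlapping⇒≺⊎≻ {nothing}           _        = inj₁ nothing≺
  nonOverlapping⇒≺⊎≻ {just _} {nothing}  _        = inj₁ ≺nothing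
  nonOverlapping⇒≺⊎≻ {just _} {just _}   (inj₁ a) = inj₁ (just≺ a)
  nonOverlapping⇒≺⊎≻ {just _} {just _}   (inj₂ b) = inj₂ (just≺ b)

  nonOverlapping-⊆ : ∀ {I J I′ J′} → I′ ⊆ I → J′ ⊆ J → NonOverlapping 𝔽 I J → NonOverlapping 𝔽 I′ J′
  nonOverlapping-⊆ p q apart with nonOverlapping⇒≺⊎≻ apart
  ... | inj₁ I≺J = ≺⇒nonOverlapping (≺-resp-⊆ p q I≺J)
  ... | inj₂ J≺I = ≻⇒nonOverlapping (≺-resp-⊆ q p J≺I)

  module _ {n : ℕ} where
    private
      ∣_∣ : Formula 𝔽 n → ℕ
      ∣_∣ = size 𝔽

      ⟦_⟧ : Formula 𝔽 n → Interval
      ⟦_⟧ = span 𝔽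

    infix 4 _≃_
    _≃_ : Formula 𝔽 n → Formula 𝔽 n → Set (c ⊔ˡ ℓ)
    _≃_ = _≋_ 𝔽

    ≃-setoid : Setoid c (c ⊔ˡ ℓ)
    ≃-setoid = record
      { Carrier       = Formula 𝔽 n
      ; _≈_           = _≃_
      ; isEquivalence = record { refl = ≋-refl ; sym = ≋-sym ; trans = ≋-trans }
      }

    open SetoidReasoning ≃-setoid

    ⊗-distribʳ : ∀ f g h → (f ⊕ g) ⊗ h ≃ f ⊗ h ⊕ g ⊗ h
    ⊗-distribʳ f g h = begin
      (f ⊕ g) ⊗ h    ≈⟨ ⊗-comm _ h ⟩
      h ⊗ (f ⊕ g)    ≈⟨ ⊗-distrib h f g ⟩
      h ⊗ f ⊕ h ⊗ g  ≈⟨ ⊕-cong (⊗-comm h f) (⊗-comm h g) ⟩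
      f ⊗ h ⊕ g ⊗ h  ∎

    ⊗-rotate : ∀ f g h k → f ⊗ g ⊗ h ⊗ k ≃ k ⊗ f ⊗ g ⊗ h
    ⊗-rotate f g h k = begin
      f ⊗ g ⊗ h ⊗ k      ≈⟨ ⊗-comm _ k ⟩
      k ⊗ (f ⊗ g ⊗ h)    ≈⟨ ≋-sym (⊗-assoc k _ h) ⟩
      k ⊗ (f ⊗ g) ⊗ h    ≈⟨ ⊗-cong (≋-sym (⊗-assoc k f g)) ≋-refl ⟩
      k ⊗ f ⊗ g ⊗ h      ∎

    f≃1⊗f⊗1⊕0 : ∀ f → f ≃ const 1# ⊗ f ⊗ const 1# ⊕ const 0#
    f≃1⊗f⊗1⊕0 f = ≋-sym (begin
      const 1# ⊗ f ⊗ const 1# ⊕ const 0#  ≈⟨ ⊕-zero _ ⟩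
      const 1# ⊗ f ⊗ const 1#             ≈⟨ ⊗-one _ ⟩
      const 1# ⊗ f                        ≈⟨ ⊗-comm _ f ⟩
      f ⊗ const 1#                        ≈⟨ ⊗-one f ⟩
      f                                   ∎)

    depth≤size : ∀ F → depth 𝔽 F ≤ ∣ F ∣
    depth≤size (var _)   = z≤n
    depth≤size (const _) = z≤n
    depth≤size (f ⊕ g)   = s≤s (≤-trans (⊔-mono-≤ (depth≤size f) (depth≤size g)) (m⊔n≤m+n (∣ f ∣) (∣ g ∣)))
    depth≤size (f ⊗ g)   = s≤s (≤-trans (⊔-mono-≤ (depth≤size f) (depth≤size g)) (m⊔n≤m+n (∣ f ∣) (∣ g ∣)))

    data Separator (M : ℕ) : Formula 𝔽 n → Set c where
      ⊕-separator : ∀ {f g} → ∣ f ∣ < M → ∣ g ∣ < M → IsInterval 𝔽 (f ⊕ g) → Separator M (f ⊕ g)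
      ⊗-separator : ∀ {f g} → ∣ f ∣ < M → ∣ g ∣ < M → IsInterval 𝔽 (f ⊗ g) → Separator M (f ⊗ g)

    record Decomposition (M : ℕ) (F : Formula 𝔽 n) : Set (c ⊔ˡ ℓ) where
      field
        L p R B     : Formula 𝔽 n
        separator   : Separator M p
        M≤∣p∣       : M ≤ ∣ p ∣
        L-interval  : IsInterval 𝔽 L
        R-interval  : IsInterval 𝔽 R
        B-interval  : IsInterval 𝔽 B
        F≃LpR+B     : F ≃ L ⊗ p ⊗ R ⊕ B
        ∣LR∣+∣p∣≤∣F∣ : ∣ L ∣ + ∣ R ∣ + ∣ p ∣ ≤ ∣ F ∣
        ∣B∣+∣p∣≤∣F∣  : ∣ B ∣ + ∣ p ∣ ≤ ∣ F ∣
        L⊆F         : ⟦ L ⟧ ⊆ ⟦ F ⟧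
        p⊆F         : ⟦ p ⟧ ⊆ ⟦ F ⟧
        R⊆F         : ⟦ R ⟧ ⊆ ⟦ F ⟧
        B⊆F         : ⟦ B ⟧ ⊆ ⟦ F ⟧
        L≺p         : ⟦ L ⟧ ≺ ⟦ p ⟧
        p≺R         : ⟦ p ⟧ ≺ ⟦ R ⟧
        L≺R         : ⟦ L ⟧ ≺ ⟦ R ⟧

    separator-decomposition : ∀ {M F} → Separator M F → M ≤ ∣ F ∣ → Decomposition M F
    separator-decomposition {F = F} sep M≤∣F∣ = record
      { L = const 1# ; p = F ; R = const 1# ; B = const 0#
      ; separator = sep ; M≤∣p∣ = M≤∣F∣
      ; L-interval = tt ; R-interval = tt ; B-interval = tt
      ; F≃LpR+B = f≃1⊗f⊗1⊕0 F
      ; ∣LR∣+∣p∣≤∣F∣ = ≤-refl ; ∣B∣+∣p∣≤∣F∣ = ≤-refl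
      ; L⊆F = nothing⊆ ; p⊆F = ⊆-refl ; R⊆F = nothing⊆ ; B⊆F = nothing⊆
      ; L≺p = nothing≺ ; p≺R = ≺nothing ; L≺R = nothing≺
      }

    Decomposition-resp : ∀ {M F F′} → F′ ≃ F → ∣ F ∣ ≤ ∣ F′ ∣ → ⟦ F ⟧ ⊆ ⟦ F′ ⟧ →
                         Decomposition M F → Decomposition M F′
    Decomposition-resp F′≃F ∣F∣≤∣F′∣ F⊆F′ d = record
      { L = L ; p = p ; R = R ; B = B
      ; separator = separator ; M≤∣p∣ = M≤∣p∣
      ; L-interval = L-interval ; R-interval = R-interval ; B-interval = B-interval
      ; F≃LpR+B = ≋-trans F′≃F F≃LpR+B
      ; ∣LR∣+∣p∣≤∣F∣ = ≤-trans ∣LR∣+∣p∣≤∣F∣ ∣F∣≤∣F′∣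
      ; ∣B∣+∣p∣≤∣F∣ = ≤-trans ∣B∣+∣p∣≤∣F∣ ∣F∣≤∣F′∣
      ; L⊆F = ⊆-trans L⊆F F⊆F′ ; p⊆F = ⊆-trans p⊆F F⊆F′
      ; R⊆F = ⊆-trans R⊆F F⊆F′ ; B⊆F = ⊆-trans B⊆F F⊆F′
      ; L≺p = L≺p ; p≺R = p≺R ; L≺R = L≺R
      }
      where open Decomposition d

    ⊕-extend : ∀ {M a b} → IsInterval 𝔽 b → Decomposition M a → Decomposition M (a ⊕ b)
    ⊕-extend {a = a} {b} ib d = record
      { L = L ; p = p ; R = R ; B = B ⊕ b
      ; separator = separator ; M≤∣p∣ = M≤∣p∣
      ; L-interval = L-interval ; R-interval = R-interval ; B-interval = B-interval , ib
      ; F≃LpR+B = ≋-trans (⊕-cong F≃LpR+B ≋-refl) (⊕-assoc _ B b)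
      ; ∣LR∣+∣p∣≤∣F∣ = ≤-trans ∣LR∣+∣p∣≤∣F∣ (≤-trans (m≤m+n (∣ a ∣) (∣ b ∣)) (n≤1+n _))
      ; ∣B∣+∣p∣≤∣F∣ = +-grow-≤ (∣ B ∣) (∣ b ∣) refl ∣B∣+∣p∣≤∣F∣
      ; L⊆F = ⊆-trans L⊆F a⊆a⊕b ; p⊆F = ⊆-trans p⊆F a⊆a⊕b ; R⊆F = ⊆-trans R⊆F a⊆a⊕b
      ; B⊆F = ∪-mono B⊆F ⊆-refl
      ; L≺p = L≺p ; p≺R = p≺R ; L≺R = L≺R
      }
      where
        open Decomposition d
        a⊆a⊕b : ⟦ a ⟧ ⊆ ⟦ a ⊕ b ⟧
        a⊆a⊕b = ∪-upperˡ ⟦ a ⟧ ⟦ b ⟧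

    ⊗-extendʳ : ∀ {M a b} → IsInterval 𝔽 b → ⟦ a ⟧ ≺ ⟦ b ⟧ → Decomposition M a → Decomposition M (a ⊗ b)
    ⊗-extendʳ {a = a} {b} ib a≺b d = record
      { L = L ; p = p ; R = R ⊗ b ; B = B ⊗ b
      ; separator = separator ; M≤∣p∣ = M≤∣p∣
      ; L-interval = L-interval
      ; R-interval = R-interval , ib , ≺⇒nonOverlapping (≺-resp-⊆ R⊆F ⊆-refl a≺b)
      ; B-interval = B-interval , ib , ≺⇒nonOverlapping (≺-resp-⊆ B⊆F ⊆-refl a≺b)
      ; F≃LpR+B = begin
          a ⊗ b                              ≈⟨ ⊗-cong F≃LpR+B ≋-refl ⟩
          (L ⊗ p ⊗ R ⊕ B) ⊗ b                ≈⟨ ⊗-distribʳ _ B b ⟩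
          L ⊗ p ⊗ R ⊗ b ⊕ B ⊗ b              ≈⟨ ⊕-cong (⊗-assoc _ R b) ≋-refl ⟩
          L ⊗ p ⊗ (R ⊗ b) ⊕ B ⊗ b            ∎
      ; ∣LR∣+∣p∣≤∣F∣ = +-grow-≤ (∣ L ∣ + ∣ R ∣) (∣ b ∣)
          (trans (+-suc ∣ L ∣ _) (cong suc (sym (+-assoc (∣ L ∣) (∣ R ∣) (∣ b ∣))))) ∣LR∣+∣p∣≤∣F∣
      ; ∣B∣+∣p∣≤∣F∣ = +-grow-≤ (∣ B ∣) (∣ b ∣) refl ∣B∣+∣p∣≤∣F∣
      ; L⊆F = ⊆-trans L⊆F a⊆a⊗b ; p⊆F = ⊆-trans p⊆F a⊆a⊗b
      ; R⊆F = ∪-mono R⊆F ⊆-refl ; B⊆F = ∪-mono B⊆F ⊆-refl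
      ; L≺p = L≺p
      ; p≺R = ≺-∪ p≺R (≺-resp-⊆ p⊆F ⊆-refl a≺b)
      ; L≺R = ≺-∪ L≺R (≺-resp-⊆ L⊆F ⊆-refl a≺b)
      }
      where
        open Decomposition d
        a⊆a⊗b : ⟦ a ⟧ ⊆ ⟦ a ⊗ b ⟧
        a⊆a⊗b = ∪-upperˡ ⟦ a ⟧ ⟦ b ⟧

    ⊗-extendˡ : ∀ {M a b} → IsInterval 𝔽 b → ⟦ b ⟧ ≺ ⟦ a ⟧ → Decomposition M a → Decomposition M (a ⊗ b)
    ⊗-extendˡ {a = a} {b} ib b≺a d = record
      { L = b ⊗ L ; p = p ; R = R ; B = B ⊗ b
      ; separator = separator ; M≤∣p∣ = M≤∣p∣
      ; L-interval = ib , L-interval , ≺⇒nonOverlapping (≺-resp-⊆ ⊆-refl L⊆F b≺a)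
      ; R-interval = R-interval
      ; B-interval = B-interval , ib , ≻⇒nonOverlapping (≺-resp-⊆ ⊆-refl B⊆F b≺a)
      ; F≃LpR+B = begin
          a ⊗ b                              ≈⟨ ⊗-cong F≃LpR+B ≋-refl ⟩
          (L ⊗ p ⊗ R ⊕ B) ⊗ b                ≈⟨ ⊗-distribʳ _ B b ⟩
          L ⊗ p ⊗ R ⊗ b ⊕ B ⊗ b              ≈⟨ ⊕-cong (⊗-rotate L p R b) ≋-refl ⟩
          b ⊗ L ⊗ p ⊗ R ⊕ B ⊗ b              ∎
      ; ∣LR∣+∣p∣≤∣F∣ = +-grow-≤ (∣ L ∣ + ∣ R ∣) (∣ b ∣)
          (cong suc (trans (+-assoc (∣ b ∣) (∣ L ∣) (∣ R ∣)) (+-comm ∣ b ∣ _))) ∣LR∣+∣p∣≤∣F∣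
      ; ∣B∣+∣p∣≤∣F∣ = +-grow-≤ (∣ B ∣) (∣ b ∣) refl ∣B∣+∣p∣≤∣F∣
      ; L⊆F = ∪-least (∪-upperʳ ⟦ a ⟧ ⟦ b ⟧) (⊆-trans L⊆F a⊆a⊗b)
      ; p⊆F = ⊆-trans p⊆F a⊆a⊗b ; R⊆F = ⊆-trans R⊆F a⊆a⊗b
      ; B⊆F = ∪-mono B⊆F ⊆-refl
      ; L≺p = ∪-≺ (≺-resp-⊆ ⊆-refl p⊆F b≺a) L≺p
      ; p≺R = p≺R
      ; L≺R = ∪-≺ (≺-resp-⊆ ⊆-refl R⊆F b≺a) L≺R
      }
      where
        open Decomposition d
        a⊆a⊗b : ⟦ a ⟧ ⊆ ⟦ a ⊗ b ⟧
        a⊆a⊗b = ∪-upperˡ ⟦ a ⟧ ⟦ b ⟧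

    ⊗-extend : ∀ {M a b} → IsInterval 𝔽 b → ⟦ a ⟧ ≺ ⟦ b ⟧ ⊎ ⟦ b ⟧ ≺ ⟦ a ⟧ →
               Decomposition M a → Decomposition M (a ⊗ b)
    ⊗-extend ib (inj₁ a≺b) = ⊗-extendʳ ib a≺b
    ⊗-extend ib (inj₂ b≺a) = ⊗-extendˡ ib b≺a

    decompose : ∀ {M} F → 0 < M → M ≤ ∣ F ∣ → IsInterval 𝔽 F → Decomposition M F
    decompose (var _)   0<M M≤0 _ = ⊥-elim (n≮0 (<-≤-trans 0<M M≤0))
    decompose (const _) 0<M M≤0 _ = ⊥-elim (n≮0 (<-≤-trans 0<M M≤0))
    decompose {M} (a ⊕ b) 0<M M≤∣F∣ (ia , ib) with M ≤? ∣ a ∣ | M ≤? ∣ b ∣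
    ... | yes M≤∣a∣ | _       = ⊕-extend ib (decompose a 0<M M≤∣a∣ ia)
    ... | no _      | yes M≤∣b∣ =
      Decomposition-resp (⊕-comm a b) (≤-reflexive (cong suc (+-comm (∣ b ∣) (∣ a ∣)))) (∪-comm-⊆ ⟦ b ⟧ ⟦ a ⟧)
        (⊕-extend ia (decompose b 0<M M≤∣b∣ ib))
    ... | no M≰∣a∣ | no M≰∣b∣ = separator-decomposition (⊕-separator (≰⇒> M≰∣a∣) (≰⇒> M≰∣b∣) (ia , ib)) M≤∣F∣
    decompose {M} (a ⊗ b) 0<M M≤∣F∣ (ia , ib , a⋈b) with M ≤? ∣ a ∣ | M ≤? ∣ b ∣
    ... | yes M≤∣a∣ | _       = ⊗-extend ib (nonOverlapping⇒≺⊎≻ a⋈b) (decompose a 0<M M≤∣a∣ ia)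
    ... | no _      | yes M≤∣b∣ =
      Decomposition-resp (⊗-comm a b) (≤-reflexive (cong suc (+-comm (∣ b ∣) (∣ a ∣)))) (∪-comm-⊆ ⟦ b ⟧ ⟦ a ⟧)
        (⊗-extend ia (swap (nonOverlapping⇒≺⊎≻ a⋈b)) (decompose b 0<M M≤∣b∣ ib))
    ... | no M≰∣a∣ | no M≰∣b∣ =
      separator-decomposition (⊗-separator (≰⇒> M≰∣a∣) (≰⇒> M≰∣b∣) (ia , ib , a⋈b)) M≤∣F∣

    record Reformulation (F : Formula 𝔽 n) (d s : ℕ) : Set (c ⊔ˡ ℓ) where
      field
        G        : Formula 𝔽 n
        interval : IsInterval 𝔽 G
        G≃F      : G ≃ F
        G⊆F      : ⟦ G ⟧ ⊆ ⟦ F ⟧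
        depth≤   : depth 𝔽 G ≤ d
        size<    : ∣ G ∣ < s

    self-reformulation : ∀ {F} → IsInterval 𝔽 F → Reformulation F (depth 𝔽 F) (suc ∣ F ∣)
    self-reformulation {F} iF = record
      { G = F ; interval = iF ; G≃F = ≋-refl ; G⊆F = ⊆-refl ; depth≤ = ≤-refl ; size< = ≤-refl }

    reformulation-≤ : ∀ {F d d′ s s′} → d ≤ d′ → s ≤ s′ → Reformulation F d s → Reformulation F d′ s′
    reformulation-≤ d≤d′ s≤s′ r = record
      { G = G ; interval = interval ; G≃F = G≃F ; G⊆F = G⊆F
      ; depth≤ = ≤-trans depth≤ d≤d′ ; size< = <-≤-trans size< s≤s′ }
      where open Reformulation r

    deepen : ∀ k {F d s} → Reformulation F d s → Reformulation F (k + d) s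
    deepen k {d = d} = reformulation-≤ (m≤n+m d k) ≤-refl

    reformulation-resp : ∀ {F F′ d s} → F′ ≃ F → ⟦ F ⟧ ⊆ ⟦ F′ ⟧ → Reformulation F d s → Reformulation F′ d s
    reformulation-resp F′≃F F⊆F′ r = record
      { G = G ; interval = interval ; G≃F = ≋-trans G≃F (≋-sym F′≃F) ; G⊆F = ⊆-trans G⊆F F⊆F′
      ; depth≤ = depth≤ ; size< = size< }
      where open Reformulation r

    ⊕-reformulation : ∀ {f g d s s′} → Reformulation f d s → Reformulation g d s′ →
                      Reformulation (f ⊕ g) (suc d) (s + s′)
    ⊕-reformulation rf rg = record
      { G = F.G ⊕ H.G ; interval = F.interval , H.interval
      ; G≃F = ⊕-cong F.G≃F H.G≃F ; G⊆F = ∪-mono F.G⊆F H.G⊆F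
      ; depth≤ = s≤s (⊔-lub F.depth≤ H.depth≤) ; size< = m<o⇒n<p⇒1+[m+n]<o+p F.size< H.size< }
      where
        module F = Reformulation rf
        module H = Reformulation rg

    ⊗-reformulation : ∀ {f g d s s′} → NonOverlapping 𝔽 ⟦ f ⟧ ⟦ g ⟧ →
                      Reformulation f d s → Reformulation g d s′ → Reformulation (f ⊗ g) (suc d) (s + s′)
    ⊗-reformulation f⋈g rf rg = record
      { G = F.G ⊗ H.G ; interval = F.interval , H.interval , nonOverlapping-⊆ F.G⊆F H.G⊆F f⋈g
      ; G≃F = ⊗-cong F.G≃F H.G≃F ; G⊆F = ∪-mono F.G⊆F H.G⊆F
      ; depth≤ = s≤s (⊔-lub F.depth≤ H.depth≤) ; size< = m<o⇒n<p⇒1+[m+n]<o+p F.size< H.size< }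
      where
        module F = Reformulation rf
        module H = Reformulation rg

    Balanced : ℕ → Set (c ⊔ˡ ℓ)
    Balanced m = ∀ F → ∣ F ∣ < 2 ^ m → IsInterval 𝔽 F → Reformulation F (4 * m) (8 ^ m)

    balanced-zero : Balanced 0
    balanced-zero F ∣F∣<1 iF =
      reformulation-≤ (≤-trans (depth≤size F) (≤-pred ∣F∣<1)) ∣F∣<1 (self-reformulation iF)

    separator-reformulation : ∀ {m p} → Balanced m → Separator (2 ^ m) p →
                              Reformulation p (suc (4 * m)) (8 ^ m + 8 ^ m)
    separator-reformulation bal (⊕-separator {f} {g} ∣f∣<M ∣g∣<M (if , ig)) =
      ⊕-reformulation (bal f ∣f∣<M if) (bal g ∣g∣<M ig)
    separator-reformulation bal (⊗-separator {f} {g} ∣f∣<M ∣g∣<M (if , ig , f⋈g)) =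
      ⊗-reformulation f⋈g (bal f ∣f∣<M if) (bal g ∣g∣<M ig)

    decomposition-reformulation : ∀ {m F} → Balanced m → ∣ F ∣ < 2 ^ suc m → Decomposition (2 ^ m) F →
                                  Reformulation F (4 * suc m) (8 ^ suc m)
    decomposition-reformulation {m} {F} bal ∣F∣<2M d =
      reformulation-resp F≃LpR+B ⟦LpR+B⟧⊆F
        (reformulation-≤ (≤-reflexive (sym (*-suc 4 m))) (x+[x+x]+x+x≤8x (8 ^ m))
          (⊕-reformulation
            (⊗-reformulation (≺⇒nonOverlapping (∪-≺ L≺R p≺R))
              (⊗-reformulation (≺⇒nonOverlapping L≺p) (deepen 1 ℒ) 𝒫)
              (deepen 2 ℛ))
            (deepen 3 ℬ)))
      where
        open Decomposition d
        ∣LR∣<M : ∣ L ∣ + ∣ R ∣ < 2 ^ m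
        ∣LR∣<M = m+n<2o⇒o≤n⇒m<o (≤-<-trans ∣LR∣+∣p∣≤∣F∣ ∣F∣<2M) M≤∣p∣
        ℒ : Reformulation L (4 * m) (8 ^ m)
        ℒ = bal L (≤-<-trans (m≤m+n (∣ L ∣) (∣ R ∣)) ∣LR∣<M) L-interval
        ℛ : Reformulation R (4 * m) (8 ^ m)
        ℛ = bal R (≤-<-trans (m≤n+m (∣ R ∣) (∣ L ∣)) ∣LR∣<M) R-interval
        ℬ : Reformulation B (4 * m) (8 ^ m)
        ℬ = bal B (m+n<2o⇒o≤n⇒m<o (≤-<-trans ∣B∣+∣p∣≤∣F∣ ∣F∣<2M) M≤∣p∣) B-interval
        𝒫 : Reformulation p (suc (4 * m)) (8 ^ m + 8 ^ m)
        𝒫 = separator-reformulation {m} bal separator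
        ⟦LpR+B⟧⊆F : ⟦ L ⊗ p ⊗ R ⊕ B ⟧ ⊆ ⟦ F ⟧
        ⟦LpR+B⟧⊆F = ∪-least (∪-least (∪-least L⊆F p⊆F) R⊆F) B⊆F

    balanced-suc : ∀ {m} → Balanced m → Balanced (suc m)
    balanced-suc {m} bal F ∣F∣<2M iF with ∣ F ∣ <? 2 ^ m
    ... | yes ∣F∣<M = reformulation-≤ (*-monoʳ-≤ 4 (n≤1+n m)) (m≤n*m (8 ^ m) 8) (bal F ∣F∣<M iF)
    ... | no ∣F∣≮M  = decomposition-reformulation bal ∣F∣<2M (decompose F (m^n>0 2 m) (≮⇒≥ ∣F∣≮M) iF)

    balanced : ∀ m → Balanced m
    balanced zero    = balanced-zero
    balanced (suc m) = balanced-suc (balanced m)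

    reformulate : ∀ F → IsInterval 𝔽 F → Reformulation F (6 * suc ⌊log₂ ∣ F ∣ ⌋) (suc (suc ∣ F ∣ ^ 6))
    reformulate F iF =
      reformulation-≤ (*-mono-≤ (m≤m+n 4 2) (bitLength≤1+⌊log₂n⌋ ∣ F ∣)) (m≤n⇒m≤1+n (8^bitLength≤[1+n]^6 ∣ F ∣))
        (balanced (bitLength ∣ F ∣) F (n<2^bitLength ∣ F ∣) iF)

mainTheorem14 : {c ℓ : Level} →
    Σ ℕ (λ k →
      (𝔽 : Field c ℓ) (n : ℕ) (F : Formula 𝔽 n) → IsInterval 𝔽 F →
      Σ (Formula 𝔽 n) (λ G →
        IsInterval 𝔽 G
        × _≋_ 𝔽 G F
        × size 𝔽 G ≤ suc (size 𝔽 F) ^ k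
        × depth 𝔽 G ≤ k * suc ⌊log₂ size 𝔽 F ⌋))
mainTheorem14 = 6 , λ 𝔽 n F iF →
  let open Reformulation (reformulate 𝔽 F iF) in G , interval , G≃F , ≤-pred size< , depth≤
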